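{- Let $A$ be a space. Nondeterministic and partial maps $A \rightsquigarrow \mathsf{Bool}$ are in bijective correspondence with pairs $(P, Q)$ of opens of $A$ (via $f \mapsto (f^*(\cdot=\mathsf{true}), f^*(\cdot=\mathsf{false}))$). Under this correspondence, the nondeterministic maps $A \to_{nd} \mathsf{Bool}$ correspond exactly to the pairs that are covering, i.e. $\top \le P \vee Q$, and the partial maps $A \rightharpoonup \mathsf{Bool}$ correspond exactly to the pairs that are disjoint, i.e. $P \wedge Q \le \bot$.
   Context: Work in a constructive metatheory. A space $A$ is given by its lattice of opens $\mathcal{O}(A)$: a distributive lattice with $\top$, $\bot$ and all joins, with binary meets distributing over arbitrary joins. A nondeterministic and partial map $f : A \rightsquigarrow B$ is a map $f^* : \mathcal{O}(B)\to\mathcal{O}(A)$ preserving all joins; it is a nondeterministic map if moreover $f^*$ preserves $\top$, and a partial map if moreover $f^*$ preserves binary meets. $\mathsf{Bool}$ is the discrete space on $\{\mathsf{true},\mathsf{false}\}$; its opens are the subsets, with singleton opens $(\cdot=\mathsf{true})$, $(\cdot=\mathsf{false})$. -}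

module Defs where

open import Data.Bool using (Bool; true; false)
open import Data.Unit using (⊤; tt)
open import Data.Empty using (⊥)
open import Data.Product using (Σ; _×_; _,_)
open import Data.Sum using (_⊎_)
open import Relation.Binary.PropositionalEquality using (_≡_)

-- A space, presented by its frame of opens: a lattice with ⊤, ⊥, binary
-- meets and joins and all (Set-indexed) joins, binary meets distributing
-- over arbitrary joins.
record Space : Set₂ where
  infix 4 _≤_
  infixr 7 _∧_
  infixr 6 _∨_
  field
    Open    : Set₁
    _≤_     : Open → Open → Set
    ≤-refl  : ∀ {x} → x ≤ x
    ≤-trans : ∀ {x y z} → x ≤ y → y ≤ z → x ≤ z
    top     : Open
    bot     : Open
    _∧_     : Open → Open → Open
    _∨_     : Open → Open → Open
    ⋁       : {I : Set} → (I → Open) → Open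
    top-max : ∀ {x} → x ≤ top
    bot-min : ∀ {x} → bot ≤ x
    ∧-lb₁   : ∀ {x y} → x ∧ y ≤ x
    ∧-lb₂   : ∀ {x y} → x ∧ y ≤ y
    ∧-glb   : ∀ {x y z} → z ≤ x → z ≤ y → z ≤ x ∧ y
    ∨-ub₁   : ∀ {x y} → x ≤ x ∨ y
    ∨-ub₂   : ∀ {x y} → y ≤ x ∨ y
    ∨-lub   : ∀ {x y z} → x ≤ z → y ≤ z → x ∨ y ≤ z
    ⋁-ub    : ∀ {I} (u : I → Open) (i : I) → u i ≤ ⋁ u
    ⋁-lub   : ∀ {I} (u : I → Open) {z} → (∀ i → u i ≤ z) → ⋁ u ≤ z
    ∧-distrib-⋁ : ∀ {I} x (u : I → Open) → x ∧ ⋁ u ≤ ⋁ (λ i → x ∧ u i)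

  infix 4 _≈_
  _≈_ : Open → Open → Set
  x ≈ y = (x ≤ y) × (y ≤ x)

BoolSpace : Space
BoolSpace = record
  { Open    = Bool → Set
  ; _≤_     = λ U V → ∀ b → U b → V b
  ; ≤-refl  = λ b u → u
  ; ≤-trans = λ p q b u → q b (p b u)
  ; top     = λ _ → ⊤
  ; bot     = λ _ → ⊥
  ; _∧_     = λ U V b → U b × V b
  ; _∨_     = λ U V b → U b ⊎ V b
  ; ⋁       = λ {I} u b → Σ I (λ i → u i b)
  ; top-max = λ b _ → tt
  ; bot-min = λ b ()
  ; ∧-lb₁   = λ b p → Data.Product.proj₁ p
  ; ∧-lb₂   = λ b p → Data.Product.proj₂ p
  ; ∧-glb   = λ p q b z → p b z , q b z
  ; ∨-ub₁   = λ b → Data.Sum.inj₁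
  ; ∨-ub₂   = λ b → Data.Sum.inj₂
  ; ∨-lub   = λ p q b → Data.Sum.[ p b , q b ]
  ; ⋁-ub    = λ u i b x → i , x
  ; ⋁-lub   = λ u h b → λ { (i , x) → h i b x }
  ; ∧-distrib-⋁ = λ x u b → λ { (p , (i , q)) → i , (p , q) }
  }

isTrue isFalse : Space.Open BoolSpace
isTrue b = b ≡ true
isFalse b = b ≡ false

-- A nondeterministic and partial map f : A ⇝ B, given by
-- f* : O(B) → O(A) (well defined on opens) preserving all joins.
record NDPMap (A B : Space) : Set₁ where
  private
    module A = Space A
    module B = Space B
  field
    pull     : B.Open → A.Open
    pull-cong : ∀ {U V} → U B.≈ V → pull U A.≈ pull V
    pull-⋁   : ∀ {I : Set} (u : I → B.Open) → pull (B.⋁ u) A.≈ A.⋁ (λ i → pull (u i))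

IsNondeterministic : ∀ {A B} → NDPMap A B → Set
IsNondeterministic {A} {B} f = NDPMap.pull f (Space.top B) ≈ Space.top A
  where open Space A using (_≈_)

IsPartial : ∀ {A B} → NDPMap A B → Set₁
IsPartial {A} {B} f =
  ∀ U V → pull (U B.∧ V) A.≈ (pull U A.∧ pull V)
  where
    open NDPMap f
    module A = Space A
    module B = Space B

module Submission where

open import Defs
open import Data.Bool using (Bool; true; false)
open import Data.Empty using (⊥)
open import Data.Product using (Σ; _×_; _,_; proj₁; proj₂)
open import Data.Sum using (_⊎_; inj₁; inj₂)
open import Function.Bundles using (_⇔_; mk⇔)
open import Relation.Binary.PropositionalEquality using (refl)

-- Every open U of Bool is the join of the singletons it contains, and f* preserves joins,
-- so f* U is the join of f*(·=true) (if true ∈ U) and f*(·=false) (if false ∈ U).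
-- Hence f is determined by the pair (P, Q), any pair arises this way, f* ⊤ = P ∨ Q, and
-- f* preserves meets exactly when the only cross term P ∧ Q vanishes.

module FrameProperties (A : Space) where
  open Space A

  ∧-comm-≤ : ∀ {x y} → x ∧ y ≤ y ∧ x
  ∧-comm-≤ = ∧-glb ∧-lb₂ ∧-lb₁

  ∧-mono : ∀ {x y x′ y′} → x ≤ x′ → y ≤ y′ → x ∧ y ≤ x′ ∧ y′
  ∧-mono p q = ∧-glb (≤-trans ∧-lb₁ p) (≤-trans ∧-lb₂ q)

  ⋁-mono : ∀ {I} {u v : I → Open} → (∀ i → u i ≤ v i) → ⋁ u ≤ ⋁ v
  ⋁-mono {v = v} u≤v = ⋁-lub _ (λ i → ≤-trans (u≤v i) (⋁-ub v i))

  ∧-distribʳ-⋁ : ∀ {I} (u : I → Open) y → ⋁ u ∧ y ≤ ⋁ (λ i → u i ∧ y)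
  ∧-distribʳ-⋁ u y =
    ≤-trans ∧-comm-≤ (≤-trans (∧-distrib-⋁ y u) (⋁-mono (λ _ → ∧-comm-≤)))

  ⋁-∧-⋁ : ∀ {I J} (u : I → Open) (v : J → Open) →
          ⋁ u ∧ ⋁ v ≤ ⋁ (λ (ij : I × J) → u (proj₁ ij) ∧ v (proj₂ ij))
  ⋁-∧-⋁ u v =
    ≤-trans (∧-distribʳ-⋁ u (⋁ v))
      (⋁-lub _ (λ i → ≤-trans (∧-distrib-⋁ (u i) v)
        (⋁-lub _ (λ j → ⋁-ub (λ ij → u (proj₁ ij) ∧ v (proj₂ ij)) (i , j)))))

module NDPMapProperties {A B : Space} (f : NDPMap A B) where
  open NDPMap f
  private
    module A = Space A
    module B = Space B

  -- f* preserves only ⋁, so U ≤ V is used in the form ⋁ {Bool} (U, V) ≈ V.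
  pull-mono : ∀ {U V} → U B.≤ V → pull U A.≤ pull V
  pull-mono {U} {V} U≤V =
    A.≤-trans (A.⋁-ub (λ b → pull (U,V b)) true)
      (A.≤-trans (proj₂ (pull-⋁ U,V)) (proj₁ (pull-cong ⋁U,V≈V)))
    where
      U,V : Bool → B.Open
      U,V true  = U
      U,V false = V

      ⋁U,V≈V : B.⋁ U,V B.≈ V
      ⋁U,V≈V = B.⋁-lub U,V (λ { true → U≤V ; false → B.≤-refl }) , B.⋁-ub U,V false

  pull-∧-≤ : ∀ U V → pull (U B.∧ V) A.≤ pull U A.∧ pull V
  pull-∧-≤ U V = A.∧-glb (pull-mono B.∧-lb₁) (pull-mono B.∧-lb₂)

  pull-bot : pull B.bot A.≤ A.bot
  pull-bot =
    A.≤-trans (proj₁ (pull-cong bot≈⋁∅))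
      (A.≤-trans (proj₁ (pull-⋁ ∅)) (A.⋁-lub _ (λ ())))
    where
      ∅ : ⊥ → B.Open
      ∅ ()

      bot≈⋁∅ : B.bot B.≈ B.⋁ ∅
      bot≈⋁∅ = B.bot-min , B.⋁-lub ∅ (λ ())

module BoolOpens where
  open Space BoolSpace

  Points : Open → Set
  Points U = U true ⊎ U false

  singleton : (U : Open) → Points U → Open
  singleton U (inj₁ _) = isTrue
  singleton U (inj₂ _) = isFalse

  ≈-⋁-singleton : ∀ U → U ≈ ⋁ (singleton U)
  ≈-⋁-singleton U =
      (λ { true u → inj₁ u , refl ; false u → inj₂ u , refl })
    , (λ { .true (inj₁ u , refl) → u ; .false (inj₂ u , refl) → u })

module BoolValuedMaps (A : Space) where
  open Space A
  open FrameProperties A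
  open BoolOpens
  private
    module B = Space BoolSpace

  -- The join ⋁ {U true} (λ _ → P) is "P if true ∈ U, else ⊥"; membership need not be decidable.
  pairPull : Open → Open → B.Open → Open
  pairPull P Q U = ⋁ {U true} (λ _ → P) ∨ ⋁ {U false} (λ _ → Q)

  module _ {P Q : Open} where

    ≤-pairPull-true : ∀ U → U true → P ≤ pairPull P Q U
    ≤-pairPull-true _ t = ≤-trans (⋁-ub (λ _ → P) t) ∨-ub₁

    ≤-pairPull-false : ∀ U → U false → Q ≤ pairPull P Q U
    ≤-pairPull-false _ e = ≤-trans (⋁-ub (λ _ → Q) e) ∨-ub₂

    pairPull-mono : ∀ {U} V → U B.≤ V → pairPull P Q U ≤ pairPull P Q V
    pairPull-mono V U≤V =
      ∨-lub (⋁-lub _ (λ t → ≤-pairPull-true V (U≤V true t)))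
            (⋁-lub _ (λ e → ≤-pairPull-false V (U≤V false e)))

    pairPull-⋁ : ∀ {I} (u : I → B.Open) → pairPull P Q (B.⋁ u) ≈ ⋁ (λ i → pairPull P Q (u i))
    pairPull-⋁ u =
        ∨-lub (⋁-lub _ (λ { (i , t) → ≤-trans (≤-pairPull-true (u i) t) (⋁-ub _ i) }))
              (⋁-lub _ (λ { (i , e) → ≤-trans (≤-pairPull-false (u i) e) (⋁-ub _ i) }))
      , ⋁-lub _ (λ i → pairPull-mono (B.⋁ u) (B.⋁-ub u i))

  pairMap : Open → Open → NDPMap A BoolSpace
  pairMap P Q = record
    { pull      = pairPull P Q
    ; pull-cong = λ { {U} {V} (U≤V , V≤U) → pairPull-mono V U≤V , pairPull-mono U V≤U }
    ; pull-⋁    = pairPull-⋁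
    }

  pairMap-true : ∀ P Q → NDPMap.pull (pairMap P Q) isTrue ≈ P
  pairMap-true P Q = ∨-lub (⋁-lub _ (λ _ → ≤-refl)) (⋁-lub _ (λ ())) , ≤-pairPull-true isTrue refl

  pairMap-false : ∀ P Q → NDPMap.pull (pairMap P Q) isFalse ≈ Q
  pairMap-false P Q = ∨-lub (⋁-lub _ (λ ())) (⋁-lub _ (λ _ → ≤-refl)) , ≤-pairPull-false isFalse refl

  pull-≈-⋁-singleton : (f : NDPMap A BoolSpace) → ∀ U →
                       NDPMap.pull f U ≈ ⋁ (λ i → NDPMap.pull f (singleton U i))
  pull-≈-⋁-singleton f U =
      ≤-trans (proj₁ (pull-cong (≈-⋁-singleton U))) (proj₁ (pull-⋁ (singleton U)))
    , ≤-trans (proj₂ (pull-⋁ (singleton U))) (proj₂ (pull-cong (≈-⋁-singleton U)))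
    where open NDPMap f

  pull-≤-pull : (f g : NDPMap A BoolSpace) →
                NDPMap.pull f isTrue ≤ NDPMap.pull g isTrue →
                NDPMap.pull f isFalse ≤ NDPMap.pull g isFalse →
                ∀ U → NDPMap.pull f U ≤ NDPMap.pull g U
  pull-≤-pull f g t e U =
    ≤-trans (proj₁ (pull-≈-⋁-singleton f U))
      (≤-trans (⋁-mono singleton-≤) (proj₂ (pull-≈-⋁-singleton g U)))
    where
      singleton-≤ : ∀ i → NDPMap.pull f (singleton U i) ≤ NDPMap.pull g (singleton U i)
      singleton-≤ (inj₁ _) = t
      singleton-≤ (inj₂ _) = e

  module _ (f : NDPMap A BoolSpace) where
    open NDPMap f
    open NDPMapProperties f

    pull-top-≈ : pull B.top ≈ pull isTrue ∨ pull isFalse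
    pull-top-≈ =
        ≤-trans (proj₁ (pull-≈-⋁-singleton f B.top))
          (⋁-lub _ (λ { (inj₁ _) → ∨-ub₁ ; (inj₂ _) → ∨-ub₂ }))
      , ∨-lub (pull-mono B.top-max) (pull-mono B.top-max)

    pull-∧-≥-of-disjoint : pull isTrue ∧ pull isFalse ≤ bot →
                           ∀ U V → pull U ∧ pull V ≤ pull (U B.∧ V)
    pull-∧-≥-of-disjoint disjoint U V =
      ≤-trans (∧-mono (proj₁ (pull-≈-⋁-singleton f U)) (proj₁ (pull-≈-⋁-singleton f V)))
        (≤-trans (⋁-∧-⋁ _ _) (⋁-lub _ (λ { (i , j) → singleton-∧ i j })))
      where
        singleton-∧ : ∀ i j → pull (singleton U i) ∧ pull (singleton V j) ≤ pull (U B.∧ V)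
        singleton-∧ (inj₁ t) (inj₁ t′) = ≤-trans ∧-lb₁ (pull-mono (λ { _ refl → t , t′ }))
        singleton-∧ (inj₂ e) (inj₂ e′) = ≤-trans ∧-lb₁ (pull-mono (λ { _ refl → e , e′ }))
        singleton-∧ (inj₁ _) (inj₂ _) = ≤-trans disjoint bot-min
        singleton-∧ (inj₂ _) (inj₁ _) = ≤-trans ∧-comm-≤ (≤-trans disjoint bot-min)

    isNondeterministic⇔covering : IsNondeterministic f ⇔ (top ≤ pull isTrue ∨ pull isFalse)
    isNondeterministic⇔covering =
      mk⇔ (λ { (_ , top≤) → ≤-trans top≤ (proj₁ pull-top-≈) })
          (λ covering → top-max , ≤-trans covering (proj₂ pull-top-≈))

    isPartial⇔disjoint : IsPartial f ⇔ (pull isTrue ∧ pull isFalse ≤ bot)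
    isPartial⇔disjoint =
      mk⇔ (λ partial → ≤-trans (proj₂ (partial isTrue isFalse))
                         (≤-trans (pull-mono (λ { _ (refl , ()) })) pull-bot))
          (λ disjoint U V → pull-∧-≤ U V , pull-∧-≥-of-disjoint disjoint U V)

proposition5p1 :
  (A : Space) →
  let open Space A
      φ₁ = λ (f : NDPMap A BoolSpace) → NDPMap.pull f isTrue
      φ₂ = λ (f : NDPMap A BoolSpace) → NDPMap.pull f isFalse
  in
  -- surjectivity of f ↦ (f*(·=true), f*(·=false))
  ((P Q : Open) → Σ (NDPMap A BoolSpace) λ f → (φ₁ f ≈ P) × (φ₂ f ≈ Q))
  -- injectivity (maps equal when their pullbacks agree on all opens)
  × ((f g : NDPMap A BoolSpace) → φ₁ f ≈ φ₁ g → φ₂ f ≈ φ₂ g →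
       ∀ U → NDPMap.pull f U ≈ NDPMap.pull g U)
  -- nondeterministic maps ↔ covering pairs
  × ((f : NDPMap A BoolSpace) → IsNondeterministic f ⇔ (top ≤ φ₁ f ∨ φ₂ f))
  -- partial maps ↔ disjoint pairs
  × ((f : NDPMap A BoolSpace) → IsPartial f ⇔ (φ₁ f ∧ φ₂ f ≤ bot))
proposition5p1 A =
    (λ P Q → pairMap P Q , pairMap-true P Q , pairMap-false P Q)
  , (λ { f g (t , t′) (e , e′) U → pull-≤-pull f g t e U , pull-≤-pull g f t′ e′ U })
  , isNondeterministic⇔covering
  , isPartial⇔disjoint
  where open BoolValuedMaps A
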